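{- Let $d$ be a positive integer, let $G=(V,E)$ be a finite connected graph and let $f_E:E\to\mathbb{Z}_d$ be an e-labeling such that $(G,f_E)$ is additive. Let $N(G,f_E)$ be the number of valid v-labelings of $(G,f_E)$. If $G$ has no simple cycle of odd length, then $N(G,f_E)=d$. If $G$ has at least one simple cycle of odd length, then $N(G,f_E)=1$ when $d$ is odd and $N(G,f_E)=2$ when $d$ is even.
   Context: $\mathbb{Z}_d$ denotes the integers modulo $d$. An e-labeling is a map $f_E:E\to\mathbb{Z}_d$ and a v-labeling is a map $f_V:V\to\mathbb{Z}_d$. A v-labeling $f_V$ is a valid v-labeling of $(G,f_E)$ if $f_E((v,v'))\equiv f_V(v)+f_V(v')\pmod d$ for every edge $(v,v')\in E$; $(G,f_E)$ is additive if a valid v-labeling exists. A simple cycle is a cycle with no repeated vertices. -}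

module Defs where

open import Data.Nat using (ℕ; zero; suc; _+_; _≤_; NonZero)
open import Data.Nat.DivMod using (_%_)
open import Data.Fin using (Fin; toℕ)
open import Data.Fin.Properties using (all?)
open import Data.Bool using (Bool; true; false; T; T?)
open import Data.List using (List; []; _∷_; [_]; _++_; length; map; concatMap; filter; allFin)
open import Data.List.Relation.Unary.Unique.Propositional using (Unique)
open import Data.Vec using (Vec; lookup) renaming ([] to []ᵛ; _∷_ to _∷ᵛ_)
open import Data.Unit using (⊤)
open import Data.Empty using (⊥)
open import Data.Product using (_×_; Σ; ∃)
open import Relation.Binary.PropositionalEquality using (_≡_)
open import Relation.Nullary using (Dec; ¬_)
open import Relation.Nullary.Decidable using (_→-dec_)
import Data.Nat.Properties as ℕP

record SimpleGraph (n : ℕ) : Set where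
  field
    adj    : Fin n → Fin n → Bool
    sym    : ∀ u v → adj u v ≡ adj v u
    irrefl : ∀ v → adj v v ≡ false
open SimpleGraph public

Adj : ∀ {n} → SimpleGraph n → Fin n → Fin n → Set
Adj G u v = T (adj G u v)

data Walk {n} (G : SimpleGraph n) : Fin n → Fin n → Set where
  nil  : ∀ {u} → Walk G u u
  cons : ∀ {u v w} → Adj G u v → Walk G v w → Walk G u w

Connected : ∀ {n} → SimpleGraph n → Set
Connected {n} G = Fin n × (∀ u v → Walk G u v)

Chain : ∀ {n} → SimpleGraph n → List (Fin n) → Set
Chain G []           = ⊤
Chain G (x ∷ [])     = ⊤
Chain G (x ∷ y ∷ xs) = Adj G x y × Chain G (y ∷ xs)

-- A simple cycle v₀ v₁ … v_{k-1} (v₀): k ≥ 3 distinct vertices, consecutive ones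
-- adjacent and v_{k-1} adjacent to v₀.  Its length is k.
SimpleCycle : ∀ {n} → SimpleGraph n → List (Fin n) → Set
SimpleCycle G []       = ⊥
SimpleCycle G (x ∷ xs) = 3 ≤ length (x ∷ xs) × Unique (x ∷ xs) × Chain G (x ∷ xs ++ [ x ])

HasOddSimpleCycle : ∀ {n} → SimpleGraph n → Set
HasOddSimpleCycle G = ∃ λ cyc → SimpleCycle G cyc × length cyc % 2 ≡ 1

-- Edges are unordered, so the label is given on ordered pairs and required to be
-- symmetric on edges (see IsELabeling); values on non-edges are irrelevant.
ELabel : ℕ → ℕ → Set
ELabel n d = Fin n → Fin n → Fin d

IsELabeling : ∀ {n d} → SimpleGraph n → ELabel n d → Set
IsELabeling G fE = ∀ u v → Adj G u v → fE u v ≡ fE v u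

-- v-labelings, as vectors (so that they can be enumerated and counted).
VLabel : ℕ → ℕ → Set
VLabel n d = Vec (Fin d) n

Valid : ∀ {n d} .{{_ : NonZero d}} → SimpleGraph n → ELabel n d → VLabel n d → Set
Valid {d = d} G fE fV =
  ∀ u v → Adj G u v → toℕ (fE u v) ≡ (toℕ (lookup fV u) + toℕ (lookup fV v)) % d

Additive : ∀ {n d} .{{_ : NonZero d}} → SimpleGraph n → ELabel n d → Set
Additive {n} {d} G fE = Σ (VLabel n d) (Valid G fE)

valid? : ∀ {n d} .{{_ : NonZero d}} (G : SimpleGraph n) (fE : ELabel n d)
         (fV : VLabel n d) → Dec (Valid G fE fV)
valid? G fE fV = all? λ u → all? λ v → T? (adj G u v) →-dec (_ ℕP.≟ _)

allVLabels : ∀ n d → List (VLabel n d)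
allVLabels zero    d = [ []ᵛ ]
allVLabels (suc n) d = concatMap (λ x → map (x ∷ᵛ_) (allVLabels n d)) (allFin d)

N : ∀ {n d} .{{_ : NonZero d}} → SimpleGraph n → ELabel n d → ℕ
N {n} {d} G fE = length (filter (valid? G fE) (allVLabels n d))

module Submission where

-- Fix a valid v-labeling g₀.  Every v-labeling g is g₀ shifted by its
-- difference s = g − g₀, and g is valid iff s solves the homogeneous system
-- s(u) + s(v) ≡ 0 (mod d) on every edge (module Shifts).  Along a walk such a
-- solution changes sign at every step (Homogeneous.along-walk), so on a
-- connected graph it is determined by its value c at one vertex b.
--  * Without odd simple cycles, the parities of walks to b form a proper
--    2-colouring (Walks.TwoColouring); this needs "an odd closed walk contains
--    an odd simple cycle", proved by splitting at repeated vertices.  Every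
--    c ∈ ℤ_d yields the solution ±c, so N = d.
--  * An odd simple cycle is an odd closed walk; it forces c ≡ −c and s
--    constant, so the solutions are the constants c with 2c ≡ 0: c = 0, and
--    c = d/2 when d is even.

open import Defs hiding (sym)
open import Data.Nat using (NonZero; ℕ; zero; suc; _+_; _∸_; _≤_; _<_; z≤n; s≤s; s≤s⁻¹; _%_; _<?_; parity)
open import Data.Nat.Properties
  using ( +-assoc; +-comm; +-identityʳ; +-suc; m+[n∸m]≡n; <⇒≤; m+n≡0⇒m≡0; ≮⇒≥; +-cancelˡ-<; +-mono-<
        ; m<m+n; n≡⌊n+n/2⌋; ≤-refl; ≤-trans; m≤m+n; +-commutativeSemigroup)
open import Data.Nat.DivMod using (m%n<n; m%n%n≡m%n; n%n≡0; m<n⇒m%n≡m; %-distribˡ-+)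
open import Data.Nat.Tactic.RingSolver using (solve-∀)
open import Algebra.Properties.CommutativeSemigroup +-commutativeSemigroup using (interchange; x∙yz≈y∙xz)
open import Data.Parity.Base as ℙ using (Parity; 0ℙ; 1ℙ; _⁻¹)
open import Data.Parity.Properties using (+-homo-+; p+p≡0ℙ)
open import Data.Bool using (T)
open import Data.Unit using (tt)
open import Data.Empty using (⊥-elim)
open import Data.Sum using (_⊎_; inj₁; inj₂)
open import Data.Product using (Σ; _,_; _×_; proj₂)
open import Data.Fin using (Fin; zero; toℕ; fromℕ<)
open import Data.Fin.Properties using (_≟_; toℕ-injective; toℕ-fromℕ<; toℕ<n)
open import Data.Vec using (lookup; tabulate) renaming ([] to []ᵛ; _∷_ to _∷ᵛ_)
open import Data.Vec.Properties using (∷-injective; lookup∘tabulate; tabulate∘lookup; tabulate-cong)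
open import Data.List using (List; []; _∷_; [_]; _++_; length; map; concatMap; filter; allFin; cartesianProductWith)
open import Data.List.Properties using (length-++; length-map; length-tabulate)
open import Data.List.Membership.Propositional using (_∈_)
open import Data.List.Membership.Propositional.Properties
  using (∈-∃++; ∈-allFin; ∈-map⁺; ∈-map⁻; ∈-filter⁺; ∈-filter⁻; ∈-cartesianProductWith⁺)
open import Data.List.Membership.Propositional.Properties.WithK using (unique∧set⇒bag)
open import Data.List.Relation.Binary.BagAndSetEquality using (∼bag⇒↭)
open import Data.List.Relation.Binary.Permutation.Propositional.Properties using (↭-length)
open import Data.List.Relation.Unary.Any using (here; there)
open import Data.List.Relation.Unary.All as All using ()
open import Data.List.Relation.Unary.All.Properties using (¬Any⇒All¬)
open import Data.List.Relation.Unary.Unique.Propositional using (Unique; []; _∷_)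
open import Data.List.Relation.Unary.Unique.Propositional.Properties using (map⁺; filter⁺; allFin⁺; cartesianProductWith⁺)
open import Function using (_∘_; id)
open import Function.Bundles using (mk⇔)
open import Relation.Unary using (Decidable)
open import Relation.Binary.Bundles using (Setoid)
open import Relation.Binary.PropositionalEquality
  using (_≡_; refl; sym; trans; cong; cong₂; subst; module ≡-Reasoning)
open import Relation.Nullary using (yes; no; ¬_)
import Relation.Binary.Reasoning.Setoid as SetoidReasoning

odd⇒%2≡1 : ∀ n → parity n ≡ 1ℙ → n % 2 ≡ 1
odd⇒%2≡1 zero          ()
odd⇒%2≡1 (suc zero)    _   = refl
odd⇒%2≡1 (suc (suc n)) odd = odd⇒%2≡1 n odd

%2≡1⇒odd : ∀ n → n % 2 ≡ 1 → parity n ≡ 1ℙ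
%2≡1⇒odd zero          ()
%2≡1⇒odd (suc zero)    _     = refl
%2≡1⇒odd (suc (suc n)) n%2≡1 = %2≡1⇒odd n n%2≡1

%2≡0⇒double : ∀ n → n % 2 ≡ 0 → Σ ℕ λ h → h + h ≡ n
%2≡0⇒double zero          _     = 0 , refl
%2≡0⇒double (suc zero)    ()
%2≡0⇒double (suc (suc n)) n%2≡0 with %2≡0⇒double n n%2≡0
... | h , h+h≡n = suc h , cong suc (trans (+-suc h h) (cong suc h+h≡n))

double-even : ∀ h → parity (h + h) ≡ 0ℙ
double-even h = trans (+-homo-+ h h) (p+p≡0ℙ (parity h))

double-injective : ∀ {a b} → a + a ≡ b + b → a ≡ b
double-injective {a} {b} 2a≡2b = trans (n≡⌊n+n/2⌋ a) (trans (cong Data.Nat.⌊_/2⌋ 2a≡2b) (sym (n≡⌊n+n/2⌋ b)))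

odd-summand : ∀ m n → parity (m + n) ≡ 1ℙ → parity m ≡ 1ℙ ⊎ parity n ≡ 1ℙ
odd-summand m n odd with parity m in eq
... | 1ℙ = inj₁ refl
... | 0ℙ = inj₂ (trans (sym (cong (ℙ._+ parity n) eq)) (trans (sym (+-homo-+ m n)) odd))

-- If two parts of positive length together fit into suc f, each fits into f
-- (the termination measure when splitting a closed walk).
part-≤ˡ : ∀ m n f → m + suc n ≤ suc f → m ≤ f
part-≤ˡ m n f m+1+n≤1+f = s≤s⁻¹ (≤-trans (m≤m+n (suc m) n) (subst (_≤ suc f) (+-suc m n) m+1+n≤1+f))

part-≤ʳ : ∀ m n f → suc m + n ≤ suc f → n ≤ f
part-≤ʳ m n f = part-≤ˡ n m f ∘ subst (_≤ suc f) (+-comm (suc m) n)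

-- Arithmetic in ℤ_d, with d = suc k, on natural-number representatives:
-- a ≈ b is congruence modulo d.  It is a record so that both sides can be
-- inferred from a proof.
module Congruence (k : ℕ) where

  d : ℕ
  d = suc k

  infix 4 _≈_
  record _≈_ (a b : ℕ) : Set where
    constructor mk≈
    field mod≡ : a % d ≡ b % d
  open _≈_ public

  ≈-setoid : Setoid _ _
  ≈-setoid = record
    { Carrier = ℕ ; _≈_ = _≈_
    ; isEquivalence = record
      { refl  = mk≈ refl
      ; sym   = λ (mk≈ p) → mk≈ (sym p)
      ; trans = λ (mk≈ p) (mk≈ q) → mk≈ (trans p q) } }

  open Setoid ≈-setoid public using () renaming (refl to ≈-refl; sym to ≈-sym; trans to ≈-trans; reflexive to ≡⇒≈)
  open SetoidReasoning ≈-setoid public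

  +-cong : ∀ {a b c e} → a ≈ b → c ≈ e → a + c ≈ b + e
  +-cong {a} {b} {c} {e} (mk≈ p) (mk≈ q) = mk≈
    (trans (%-distribˡ-+ a c d) (trans (cong₂ (λ x y → (x + y) % d) p q) (sym (%-distribˡ-+ b e d))))

  +-congˡ : ∀ a {b c} → b ≈ c → a + b ≈ a + c
  +-congˡ a = +-cong (≈-refl {a})

  +-congʳ : ∀ c {a b} → a ≈ b → a + c ≈ b + c
  +-congʳ c a≈b = +-cong a≈b (≈-refl {c})

  %-≈ : ∀ a → a % d ≈ a
  %-≈ a = mk≈ (m%n%n≡m%n a d)

  d≈0 : d ≈ 0
  d≈0 = mk≈ (n%n≡0 d)

  ≈-canonical : ∀ {a b} → a < d → b < d → a ≈ b → a ≡ b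
  ≈-canonical a<d b<d (mk≈ p) = trans (sym (m<n⇒m%n≡m a<d)) (trans p (m<n⇒m%n≡m b<d))

  neg : ℕ → ℕ
  neg c = d ∸ c % d

  +-neg : ∀ c → c + neg c ≈ 0
  +-neg c = begin
    c + neg c            ≈⟨ +-congʳ (neg c) (≈-sym (%-≈ c)) ⟩
    c % d + (d ∸ c % d)  ≡⟨ m+[n∸m]≡n (<⇒≤ (m%n<n c d)) ⟩
    d                    ≈⟨ d≈0 ⟩
    0                    ∎

  neg-+ : ∀ c → neg c + c ≈ 0
  neg-+ c = ≈-trans (≡⇒≈ (+-comm (neg c) c)) (+-neg c)

  neg-cong : ∀ {a b} → a ≈ b → neg a ≡ neg b
  neg-cong (mk≈ p) = cong (d ∸_) p

  +-cancelˡ : ∀ {a b c} → c + a ≈ c + b → a ≈ b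
  +-cancelˡ {a} {b} {c} c+a≈c+b = begin
    a                ≈⟨ +-congʳ a (≈-sym (neg-+ c)) ⟩
    neg c + c + a    ≡⟨ +-assoc (neg c) c a ⟩
    neg c + (c + a)  ≈⟨ +-congˡ (neg c) c+a≈c+b ⟩
    neg c + (c + b)  ≡⟨ sym (+-assoc (neg c) c b) ⟩
    neg c + c + b    ≈⟨ +-congʳ b (neg-+ c) ⟩
    b                ∎

  inverse-unique : ∀ {a b} → a + b ≈ 0 → a ≈ neg b
  inverse-unique {a} {b} a+b≈0 = +-cancelˡ {c = b} (≈-trans (≡⇒≈ (+-comm b a)) (≈-trans a+b≈0 (≈-sym (+-neg b))))

  neg-involutive : ∀ c → neg (neg c) ≈ c
  neg-involutive c = ≈-sym (inverse-unique (+-neg c))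

  double≈0 : ∀ {K} → K < d → K + K ≈ 0 → K ≡ 0 ⊎ K + K ≡ d
  double≈0 {K} K<d 2K≈0 with K + K <? d
  ... | yes 2K<d = inj₁ (m+n≡0⇒m≡0 K (≈-canonical 2K<d (s≤s z≤n) 2K≈0))
  ... | no 2K≮d = inj₂ (trans 2K≡d+r (trans (cong (d +_) r≡0) (+-identityʳ d)))
    where
    r : ℕ
    r = K + K ∸ d
    2K≡d+r : K + K ≡ d + r
    2K≡d+r = sym (m+[n∸m]≡n (≮⇒≥ 2K≮d))
    r≡0 : r ≡ 0
    r≡0 = ≈-canonical (+-cancelˡ-< d r d (subst (_< d + d) 2K≡d+r (+-mono-< K<d K<d))) (s≤s z≤n)
            (≈-trans (+-congʳ r (≈-sym d≈0)) (≈-trans (≡⇒≈ (sym 2K≡d+r)) 2K≈0))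

module Walks {n : ℕ} (G : SimpleGraph n) where
  open import Data.List.Membership.DecPropositional (_≟_ {n}) using (_∈?_)

  adj-sym : ∀ {u v} → Adj G u v → Adj G v u
  adj-sym {u} {v} = subst T (SimpleGraph.sym G u v)

  adj-irrefl : ∀ {a} → ¬ Adj G a a
  adj-irrefl {a} a~a = subst T (SimpleGraph.irrefl G a) a~a

  len : ∀ {u v} → Walk G u v → ℕ
  len nil        = 0
  len (cons _ w) = suc (len w)

  infixr 5 _++ʷ_
  _++ʷ_ : ∀ {a b c} → Walk G a b → Walk G b c → Walk G a c
  nil      ++ʷ w′ = w′
  cons p w ++ʷ w′ = cons p (w ++ʷ w′)

  len-++ʷ : ∀ {a b c} (w : Walk G a b) (w′ : Walk G b c) → len (w ++ʷ w′) ≡ len w + len w′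
  len-++ʷ nil        w′ = refl
  len-++ʷ (cons p w) w′ = cong suc (len-++ʷ w w′)

  reverse : ∀ {a b} → Walk G a b → Walk G b a
  reverse nil        = nil
  reverse (cons p w) = reverse w ++ʷ cons (adj-sym p) nil

  len-reverse : ∀ {a b} (w : Walk G a b) → len (reverse w) ≡ len w
  len-reverse nil        = refl
  len-reverse (cons p w) = trans (len-++ʷ (reverse w) _) (trans (cong (_+ 1) (len-reverse w)) (+-comm (len w) 1))

  -- A walk from a to b described by the list of its interior vertices; this
  -- form allows cutting a walk at a vertex occurrence.
  Via : Fin n → List (Fin n) → Fin n → Set
  Via a []      b = Adj G a b
  Via a (m ∷ l) b = Adj G a m × Via m l b

  via-split : ∀ {a b m} l₁ l₂ → Via a (l₁ ++ m ∷ l₂) b → Via a l₁ m × Via m l₂ b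
  via-split []       l₂ (a~m , w) = a~m , w
  via-split (x ∷ l₁) l₂ (a~x , w) with via-split l₁ l₂ w
  ... | w₁ , w₂ = (a~x , w₁) , w₂

  via-join : ∀ {a b m} l₁ l₂ → Via a l₁ m → Via m l₂ b → Via a (l₁ ++ m ∷ l₂) b
  via-join []       l₂ a~m       w₂ = a~m , w₂
  via-join (x ∷ l₁) l₂ (a~x , w₁) w₂ = a~x , via-join l₁ l₂ w₁ w₂

  via⇒chain : ∀ {a b} l → Via a l b → Chain G (a ∷ l ++ [ b ])
  via⇒chain []      a~b       = a~b , tt
  via⇒chain (x ∷ l) (a~x , w) = a~x , via⇒chain l w

  walk⇒via : ∀ {a v c} → Adj G a v → (w : Walk G v c) → Σ (List (Fin n)) λ l → Via a l c × length l ≡ len w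
  walk⇒via a~v nil = [] , a~v , refl
  walk⇒via {v = v} a~v (cons v~x w) with walk⇒via v~x w
  ... | l , via , l≡w = v ∷ l , (a~v , via) , cong suc l≡w

  chain⇒walk : ∀ a l b → Chain G (a ∷ l ++ [ b ]) → Σ (Walk G a b) λ w → len w ≡ suc (length l)
  chain⇒walk a []      b (a~b , _) = cons a~b nil , refl
  chain⇒walk a (x ∷ l) b (a~x , c) with chain⇒walk x l b c
  ... | w , w≡l = cons a~x w , cong suc w≡l

  Loop : Set
  Loop = Σ (Fin n) λ a → Σ (List (Fin n)) λ l → Via a l a

  loop-length : Loop → ℕ
  loop-length (_ , l , _) = suc (length l)

  Repeat : List (Fin n) → Set
  Repeat xs = Σ (List (Fin n)) λ l₁ → Σ (Fin n) λ y → Σ (List (Fin n)) λ l₂ → Σ (List (Fin n)) λ l₃ →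
              xs ≡ l₁ ++ y ∷ l₂ ++ y ∷ l₃

  unique-or-repeat : ∀ xs → Unique xs ⊎ Repeat xs
  unique-or-repeat [] = inj₁ []
  unique-or-repeat (x ∷ xs) with x ∈? xs
  ... | yes x∈xs with ∈-∃++ x∈xs
  ...   | l₂ , l₃ , eq = inj₂ ([] , x , l₂ , l₃ , cong (x ∷_) eq)
  unique-or-repeat (x ∷ xs) | no x∉xs with unique-or-repeat xs
  ... | inj₁ u = inj₁ (¬Any⇒All¬ xs x∉xs ∷ u)
  ... | inj₂ (l₁ , y , l₂ , l₃ , eq) = inj₂ (x ∷ l₁ , y , l₂ , l₃ , cong (x ∷_) eq)

  -- Cutting out the closed walk between two occurrences of y.
  length-excise : ∀ (l₁ : List (Fin n)) y l₂ l₃ →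
    suc (length l₂) + suc (length (l₁ ++ y ∷ l₃)) ≡ suc (length (l₁ ++ y ∷ l₂ ++ y ∷ l₃))
  length-excise l₁ y l₂ l₃
    rewrite length-++ l₁ {y ∷ l₃} | length-++ l₁ {y ∷ l₂ ++ y ∷ l₃} | length-++ l₂ {y ∷ l₃}
    = arith (length l₁) (length l₂) (length l₃)
    where
    arith : ∀ a b c → suc b + suc (a + suc c) ≡ suc (a + suc (b + suc c))
    arith = solve-∀

  split-loop : ∀ a l → Via a l a → Repeat (a ∷ l) →
    Σ Loop λ ℓ₁ → Σ Loop λ ℓ₂ → loop-length ℓ₁ + loop-length ℓ₂ ≡ suc (length l)
  split-loop a .(l₂ ++ a ∷ l₃) w ([] , .a , l₂ , l₃ , refl) with via-split l₂ l₃ w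
  ... | w₁ , w₂ = (a , l₂ , w₁) , (a , l₃ , w₂) , cong suc (sym (length-++ l₂))
  split-loop a .(l₁ ++ y ∷ l₂ ++ y ∷ l₃) w (.a ∷ l₁ , y , l₂ , l₃ , refl)
    with via-split l₁ (l₂ ++ y ∷ l₃) w
  ... | w₁ , w₂₃ with via-split l₂ l₃ w₂₃
  ...   | w₂ , w₃ = (y , l₂ , w₂) , (a , l₁ ++ y ∷ l₃ , via-join l₁ l₃ w₁ w₃) , length-excise l₁ y l₂ l₃

  distinct-odd-loop⇒cycle : ∀ a l → Via a l a → Unique (a ∷ l) → parity (suc (length l)) ≡ 1ℙ →
    HasOddSimpleCycle G
  distinct-odd-loop⇒cycle a []          a~a u odd = ⊥-elim (adj-irrefl a~a)
  distinct-odd-loop⇒cycle a (x ∷ [])    w   u ()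
  distinct-odd-loop⇒cycle a (x ∷ y ∷ l) w   u odd =
    a ∷ x ∷ y ∷ l , (s≤s (s≤s (s≤s z≤n)) , u , via⇒chain (x ∷ y ∷ l) w) , odd⇒%2≡1 (length (a ∷ x ∷ y ∷ l)) odd

  -- Every odd loop contains an odd simple cycle: either its vertices are
  -- distinct, or it splits into two shorter loops one of which is odd.
  odd-loop⇒cycle : ∀ bound (ℓ : Loop) → loop-length ℓ ≤ bound → parity (loop-length ℓ) ≡ 1ℙ →
    HasOddSimpleCycle G
  odd-loop⇒cycle zero    (a , l , w) ()    odd
  odd-loop⇒cycle (suc f) (a , l , w) ℓ≤1+f odd with unique-or-repeat (a ∷ l)
  ... | inj₁ distinct = distinct-odd-loop⇒cycle a l w distinct odd
  ... | inj₂ rep with split-loop a l w rep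
  ...   | ℓ₁ , ℓ₂ , sum with odd-summand (loop-length ℓ₁) (loop-length ℓ₂) (subst (λ m → parity m ≡ 1ℙ) (sym sum) odd)
  ...     | inj₁ odd₁ = odd-loop⇒cycle f ℓ₁ (part-≤ˡ _ _ f (subst (_≤ suc f) (sym sum) ℓ≤1+f)) odd₁
  ...     | inj₂ odd₂ = odd-loop⇒cycle f ℓ₂ (part-≤ʳ _ _ f (subst (_≤ suc f) (sym sum) ℓ≤1+f)) odd₂

  odd-closed-walk⇒cycle : ∀ {a} (w : Walk G a a) → parity (len w) ≡ 1ℙ → HasOddSimpleCycle G
  odd-closed-walk⇒cycle nil ()
  odd-closed-walk⇒cycle {a} (cons a~v w) odd with walk⇒via a~v w
  ... | l , via , l≡w = odd-loop⇒cycle _ (a , l , via) ≤-refl (subst (λ m → parity (suc m) ≡ 1ℙ) (sym l≡w) odd)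

  cycle⇒odd-closed-walk : HasOddSimpleCycle G → Σ (Fin n) λ b → Σ (Walk G b b) λ w → parity (len w) ≡ 1ℙ
  cycle⇒odd-closed-walk (a ∷ l , (_ , _ , chain) , odd) with chain⇒walk a l a chain
  ... | w , w≡l = a , w , trans (cong parity w≡l) (%2≡1⇒odd (suc (length l)) odd)

  module TwoColouring (b : Fin n) (path : ∀ u v → Walk G u v) (no-odd : ¬ HasOddSimpleCycle G) where

    colour : Fin n → Parity
    colour u = parity (len (path u b))

    detour : ∀ {u v} → Adj G u v → Walk G u u
    detour {u} {v} u~v = cons u~v (path v b ++ʷ reverse (path u b))

    detour-parity : ∀ {u v} (u~v : Adj G u v) → parity (len (detour u~v)) ≡ 1ℙ ℙ.+ (colour v ℙ.+ colour u)
    detour-parity {u} {v} u~v = begin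
      parity (1 + len (path v b ++ʷ reverse (path u b)))   ≡⟨ +-homo-+ 1 (len (path v b ++ʷ reverse (path u b))) ⟩
      1ℙ ℙ.+ parity (len (path v b ++ʷ reverse (path u b))) ≡⟨ cong (λ m → 1ℙ ℙ.+ parity m) lengths ⟩
      1ℙ ℙ.+ parity (len (path v b) + len (path u b))       ≡⟨ cong (1ℙ ℙ.+_) (+-homo-+ (len (path v b)) _) ⟩
      1ℙ ℙ.+ (colour v ℙ.+ colour u)                         ∎
      where
      open ≡-Reasoning
      lengths : len (path v b ++ʷ reverse (path u b)) ≡ len (path v b) + len (path u b)
      lengths = trans (len-++ʷ (path v b) _) (cong (len (path v b) +_) (len-reverse (path u b)))

    -- Equal colours at the ends of an edge would make the detour odd.
    colour-flips : ∀ {u v} → Adj G u v → colour u ≡ colour v ⁻¹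
    colour-flips {u} {v} u~v with colour u | colour v | detour-parity u~v
    ... | 0ℙ | 1ℙ | _   = refl
    ... | 1ℙ | 0ℙ | _   = refl
    ... | 0ℙ | 0ℙ | odd = ⊥-elim (no-odd (odd-closed-walk⇒cycle (detour u~v) odd))
    ... | 1ℙ | 1ℙ | odd = ⊥-elim (no-odd (odd-closed-walk⇒cycle (detour u~v) odd))

-- Solutions in ℤ_d of the homogeneous system  s(u) + s(v) ≡ 0  (one equation
-- per edge); they are the differences between two valid v-labelings.
module Homogeneous (k : ℕ) {n : ℕ} (G : SimpleGraph n) where
  open Congruence k
  open Walks G

  Homogeneous : (Fin n → ℕ) → Set
  Homogeneous s = ∀ u v → Adj G u v → s u + s v ≈ 0

  signed : Parity → ℕ → ℕ
  signed 0ℙ c = c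
  signed 1ℙ c = neg c

  signed-cong : ∀ p {a b} → a ≈ b → signed p a ≈ signed p b
  signed-cong 0ℙ a≈b = a≈b
  signed-cong 1ℙ a≈b = ≡⇒≈ (neg-cong a≈b)

  neg-signed : ∀ p c → neg (signed p c) ≈ signed (p ⁻¹) c
  neg-signed 0ℙ c = ≈-refl
  neg-signed 1ℙ c = neg-involutive c

  signed-involutive : ∀ p c → signed p (signed p c) ≈ c
  signed-involutive 0ℙ c = ≈-refl
  signed-involutive 1ℙ c = neg-involutive c

  signed-opposite : ∀ p c → signed (p ⁻¹) c + signed p c ≈ 0
  signed-opposite 0ℙ c = neg-+ c
  signed-opposite 1ℙ c = +-neg c

  signed-self-inverse : ∀ p {c} → c + c ≈ 0 → signed p c ≈ c
  signed-self-inverse 0ℙ c+c≈0 = ≈-refl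
  signed-self-inverse 1ℙ c+c≈0 = ≈-sym (inverse-unique c+c≈0)

  -- Along a walk a solution changes sign at every step, so its value at the
  -- start is ± its value at the end, according to the parity of the length.
  along-walk : ∀ s → Homogeneous s → ∀ {u b} (w : Walk G u b) → s u ≈ signed (parity (len w)) (s b)
  along-walk s hom nil = ≈-refl
  along-walk s hom {u} {b} (cons {v = v} u~v w) = begin
    s u                                  ≈⟨ inverse-unique (hom u v u~v) ⟩
    neg (s v)                            ≡⟨ neg-cong (along-walk s hom w) ⟩
    neg (signed (parity (len w)) (s b))  ≈⟨ neg-signed (parity (len w)) (s b) ⟩
    signed (parity (len w) ⁻¹) (s b)     ≡⟨ cong (λ p → signed p (s b)) (sym (+-homo-+ 1 (len w))) ⟩
    signed (parity (suc (len w))) (s b)  ∎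

  odd-walk⇒constant : ∀ s → Homogeneous s → ∀ {b} (w : Walk G b b) → parity (len w) ≡ 1ℙ →
    (∀ u → Walk G u b) → s b + s b ≈ 0 × (∀ u → s u ≈ s b)
  odd-walk⇒constant s hom {b} w odd path = 2sb≈0 , constant
    where
    sb≈-sb : s b ≈ neg (s b)
    sb≈-sb = subst (λ p → s b ≈ signed p (s b)) odd (along-walk s hom w)
    2sb≈0 : s b + s b ≈ 0
    2sb≈0 = ≈-trans (+-congʳ (s b) sb≈-sb) (neg-+ (s b))
    constant : ∀ u → s u ≈ s b
    constant u = ≈-trans (along-walk s hom (path u)) (signed-self-inverse (parity (len (path u))) 2sb≈0)

  constant-homogeneous : ∀ c → c + c ≈ 0 → Homogeneous (λ _ → c)
  constant-homogeneous c c+c≈0 _ _ _ = c+c≈0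

  coloured-homogeneous : (colour : Fin n → Parity) → (∀ {u v} → Adj G u v → colour u ≡ colour v ⁻¹) →
    ∀ c → Homogeneous (λ u → signed (colour u) c)
  coloured-homogeneous colour flips c u v u~v rewrite flips u~v = signed-opposite (colour v) c

module Shifts (k : ℕ) {n : ℕ} (G : SimpleGraph n) (fE : ELabel n (suc k))
              (g₀ : VLabel n (suc k)) (g₀-valid : Valid G fE g₀) where
  open Congruence k
  open Homogeneous k G

  val : VLabel n d → Fin n → ℕ
  val g u = toℕ (lookup g u)

  valid-sums : ∀ g → Valid G fE g → ∀ {u v} → Adj G u v → val g u + val g v ≈ val g₀ u + val g₀ v
  valid-sums g g-valid {u} {v} u~v = mk≈ (trans (sym (g-valid u v u~v)) (g₀-valid u v u~v))

  shift : (Fin n → ℕ) → VLabel n d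
  shift s = tabulate λ u → fromℕ< (m%n<n (val g₀ u + s u) d)

  val-shift : ∀ s u → val (shift s) u ≈ val g₀ u + s u
  val-shift s u = ≈-trans (≡⇒≈ (trans (cong toℕ (lookup∘tabulate _ u)) (toℕ-fromℕ< _))) (%-≈ _)

  shift-valid : ∀ s → Homogeneous s → Valid G fE (shift s)
  shift-valid s hom u v u~v = trans (g₀-valid u v u~v) (sym (mod≡ sums))
    where
    sums : val (shift s) u + val (shift s) v ≈ val g₀ u + val g₀ v
    sums = begin
      val (shift s) u + val (shift s) v    ≈⟨ +-cong (val-shift s u) (val-shift s v) ⟩
      (val g₀ u + s u) + (val g₀ v + s v)  ≡⟨ interchange (val g₀ u) (s u) (val g₀ v) (s v) ⟩
      (val g₀ u + val g₀ v) + (s u + s v)  ≈⟨ +-congˡ (val g₀ u + val g₀ v) (hom u v u~v) ⟩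
      (val g₀ u + val g₀ v) + 0            ≡⟨ +-identityʳ (val g₀ u + val g₀ v) ⟩
      val g₀ u + val g₀ v                  ∎

  shift-cong : ∀ {s s′} → (∀ u → s u ≈ s′ u) → shift s ≡ shift s′
  shift-cong s≈s′ = tabulate-cong λ u → toℕ-injective
    (trans (toℕ-fromℕ< _) (trans (mod≡ (+-congˡ (val g₀ u) (s≈s′ u))) (sym (toℕ-fromℕ< _))))

  shift-injective : ∀ s s′ → shift s ≡ shift s′ → ∀ u → s u ≈ s′ u
  shift-injective s s′ eq u = +-cancelˡ (begin
    val g₀ u + s u   ≈⟨ ≈-sym (val-shift s u) ⟩
    val (shift s) u  ≡⟨ cong (λ g → val g u) eq ⟩
    val (shift s′) u ≈⟨ val-shift s′ u ⟩
    val g₀ u + s′ u  ∎)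

  difference : VLabel n d → Fin n → ℕ
  difference g u = val g u + neg (val g₀ u)

  difference-homogeneous : ∀ g → Valid G fE g → Homogeneous (difference g)
  difference-homogeneous g g-valid u v u~v = begin
    (val g u + neg (val g₀ u)) + (val g v + neg (val g₀ v))   ≡⟨ interchange (val g u) _ (val g v) _ ⟩
    (val g u + val g v) + (neg (val g₀ u) + neg (val g₀ v))   ≈⟨ +-congʳ _ (valid-sums g g-valid u~v) ⟩
    (val g₀ u + val g₀ v) + (neg (val g₀ u) + neg (val g₀ v)) ≡⟨ interchange (val g₀ u) (val g₀ v) _ _ ⟩
    (val g₀ u + neg (val g₀ u)) + (val g₀ v + neg (val g₀ v)) ≈⟨ +-cong (+-neg (val g₀ u)) (+-neg (val g₀ v)) ⟩
    0                                                         ∎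

  shift-difference : ∀ g → g ≡ shift (difference g)
  shift-difference g = trans (sym (tabulate∘lookup g)) (tabulate-cong λ u → toℕ-injective
    (trans (≈-canonical (toℕ<n (lookup g u)) (toℕ<n (lookup (shift (difference g)) u)) (≈-sym (same u)))
           (cong toℕ (lookup∘tabulate _ u))))
    where
    same : ∀ u → val (shift (difference g)) u ≈ val g u
    same u = begin
      val (shift (difference g)) u           ≈⟨ val-shift (difference g) u ⟩
      val g₀ u + (val g u + neg (val g₀ u))  ≡⟨ x∙yz≈y∙xz (val g₀ u) (val g u) _ ⟩
      val g u + (val g₀ u + neg (val g₀ u))  ≈⟨ +-congˡ (val g u) (+-neg (val g₀ u)) ⟩
      val g u + 0                            ≡⟨ +-identityʳ (val g u) ⟩
      val g u                                ∎

concatMap-map : ∀ {A B C : Set} (f : A → B → C) xs ys →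
  concatMap (λ x → map (f x) ys) xs ≡ cartesianProductWith f xs ys
concatMap-map f []       ys = refl
concatMap-map f (x ∷ xs) ys = cong (map (f x) ys ++_) (concatMap-map f xs ys)

allVLabels-complete : ∀ n d (g : VLabel n d) → g ∈ allVLabels n d
allVLabels-complete zero    d []ᵛ       = here refl
allVLabels-complete (suc n) d (x ∷ᵛ g) = subst (x ∷ᵛ g ∈_) (sym (concatMap-map _∷ᵛ_ (allFin d) (allVLabels n d)))
  (∈-cartesianProductWith⁺ _∷ᵛ_ (∈-allFin x) (allVLabels-complete n d g))

allVLabels-unique : ∀ n d → Unique (allVLabels n d)
allVLabels-unique zero    d = All.[] ∷ []
allVLabels-unique (suc n) d = subst Unique (sym (concatMap-map _∷ᵛ_ (allFin d) (allVLabels n d)))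
  (cartesianProductWith⁺ _∷ᵛ_ ∷-injective (allFin⁺ d) (allVLabels-unique n d))

count-filter : ∀ {A : Set} {P : A → Set} (P? : Decidable P) {xs ys : List A} →
  Unique xs → (∀ z → z ∈ xs) → Unique ys → (∀ {z} → z ∈ ys → P z) → (∀ {z} → P z → z ∈ ys) →
  length (filter P? xs) ≡ length ys
count-filter P? {xs} xs-unique xs-complete ys-unique ys⇒P P⇒ys = ↭-length (∼bag⇒↭ (unique∧set⇒bag
  (filter⁺ P? xs-unique) ys-unique
  (mk⇔ (λ z∈ → P⇒ys (proj₂ (∈-filter⁻ P? {xs = xs} z∈))) (λ z∈ys → ∈-filter⁺ P? (xs-complete _) (ys⇒P z∈ys)))))

count-valid : ∀ {n k} (G : SimpleGraph n) (fE : ELabel n (suc k)) {A : Set} (f : A → VLabel n (suc k)) →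
  (∀ {a b} → f a ≡ f b → a ≡ b) → (cs : List A) → Unique cs →
  (∀ {c} → c ∈ cs → Valid G fE (f c)) → (∀ g → Valid G fE g → Σ A λ c → c ∈ cs × g ≡ f c) →
  N G fE ≡ length cs
count-valid {n} {k} G fE f f-injective cs cs-unique valid-codes all-codes =
  trans (count-filter (valid? G fE) (allVLabels-unique n (suc k)) (allVLabels-complete n (suc k))
                      (map⁺ f-injective cs-unique) image⇒valid valid⇒image)
        (length-map f cs)
  where
  image⇒valid : ∀ {g} → g ∈ map f cs → Valid G fE g
  image⇒valid g∈ with ∈-map⁻ f g∈
  ... | c , c∈cs , refl = valid-codes c∈cs
  valid⇒image : ∀ {g} → Valid G fE g → g ∈ map f cs
  valid⇒image {g} g-valid with all-codes g g-valid
  ... | c , c∈cs , refl = ∈-map⁺ f c∈cs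

module Count (k : ℕ) {n : ℕ} (G : SimpleGraph n) (fE : ELabel n (suc k))
             (g₀ : VLabel n (suc k)) (g₀-valid : Valid G fE g₀) (path : ∀ u v → Walk G u v) where
  open Congruence k
  open Walks G
  open Homogeneous k G
  open Shifts k G fE g₀ g₀-valid

  count-bipartite : Fin n → ¬ HasOddSimpleCycle G → N G fE ≡ d
  count-bipartite b no-odd =
    trans (count-valid G fE coloured coloured-injective (allFin d) (allFin⁺ d) (λ {c} _ → coloured-valid c) classify)
          (length-tabulate id)
    where
    open TwoColouring b path no-odd

    coloured : Fin d → VLabel n d
    coloured c = shift (λ u → signed (colour u) (toℕ c))

    coloured-valid : ∀ c → Valid G fE (coloured c)
    coloured-valid c = shift-valid _ (coloured-homogeneous colour colour-flips (toℕ c))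

    coloured-injective : ∀ {c c′} → coloured c ≡ coloured c′ → c ≡ c′
    coloured-injective {c} {c′} eq = toℕ-injective (≈-canonical (toℕ<n c) (toℕ<n c′) (begin
      toℕ c                                          ≈⟨ ≈-sym (signed-involutive (colour b) (toℕ c)) ⟩
      signed (colour b) (signed (colour b) (toℕ c))  ≈⟨ signed-cong (colour b) (shift-injective _ _ eq b) ⟩
      signed (colour b) (signed (colour b) (toℕ c′)) ≈⟨ signed-involutive (colour b) (toℕ c′) ⟩
      toℕ c′                                         ∎))

    classify : ∀ g → Valid G fE g → Σ (Fin d) λ c → c ∈ allFin d × g ≡ coloured c
    classify g g-valid = c , ∈-allFin c , trans (shift-difference g) (shift-cong agree)
      where
      s : Fin n → ℕ
      s = difference g
      c : Fin d
      c = fromℕ< (m%n<n (s b) d)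
      sb≈c : s b ≈ toℕ c
      sb≈c = ≈-sym (≈-trans (≡⇒≈ (toℕ-fromℕ< _)) (%-≈ (s b)))
      agree : ∀ u → s u ≈ signed (colour u) (toℕ c)
      agree u = ≈-trans (along-walk s (difference-homogeneous g g-valid) (path u b)) (signed-cong (colour u) sb≈c)

  module OddCycleCase (b : Fin n) (cw : Walk G b b) (odd : parity (len cw) ≡ 1ℙ) where

    constant : Fin d → VLabel n d
    constant c = shift (λ _ → toℕ c)

    constant-injective : ∀ {c c′} → constant c ≡ constant c′ → c ≡ c′
    constant-injective {c} {c′} eq = toℕ-injective (≈-canonical (toℕ<n c) (toℕ<n c′) (shift-injective _ _ eq b))

    constant-valid : ∀ c → toℕ c + toℕ c ≈ 0 → Valid G fE (constant c)
    constant-valid c 2c≈0 = shift-valid _ (constant-homogeneous (toℕ c) 2c≈0)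

    classify : ∀ g → Valid G fE g → Σ (Fin d) λ c → (toℕ c ≡ 0 ⊎ toℕ c + toℕ c ≡ d) × g ≡ constant c
    classify g g-valid with odd-walk⇒constant (difference g) (difference-homogeneous g g-valid) cw odd (λ u → path u b)
    ... | 2sb≈0 , s≈sb = c , double≈0 (toℕ<n c) 2c≈0 , trans (shift-difference g) (shift-cong λ u → ≈-trans (s≈sb u) sb≈c)
      where
      s : Fin n → ℕ
      s = difference g
      c : Fin d
      c = fromℕ< (m%n<n (s b) d)
      sb≈c : s b ≈ toℕ c
      sb≈c = ≈-sym (≈-trans (≡⇒≈ (toℕ-fromℕ< _)) (%-≈ (s b)))
      2c≈0 : toℕ c + toℕ c ≈ 0
      2c≈0 = ≈-trans (+-cong (≈-sym sb≈c) (≈-sym sb≈c)) 2sb≈0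

    count-d-odd : d % 2 ≡ 1 → N G fE ≡ 1
    count-d-odd d-odd = count-valid G fE constant constant-injective [ zero ] (All.[] ∷ [])
      (λ { (here refl) → constant-valid zero ≈-refl }) only-zero
      where
      only-zero : ∀ g → Valid G fE g → Σ (Fin d) λ c → c ∈ [ zero ] × g ≡ constant c
      only-zero g g-valid with classify g g-valid
      ... | c , inj₁ c≡0  , g≡ = c , here (toℕ-injective c≡0) , g≡
      ... | c , inj₂ 2c≡d , g≡ with trans (sym (double-even (toℕ c))) (trans (cong parity 2c≡d) (%2≡1⇒odd d d-odd))
      ...   | ()

    count-d-even : d % 2 ≡ 0 → N G fE ≡ 2
    count-d-even d-even with %2≡0⇒double d d-even
    ... | zero  , ()
    ... | suc h′ , h+h≡d = count-valid G fE constant constant-injective (zero ∷ half ∷ [])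
          ((zero≢half All.∷ All.[]) ∷ All.[] ∷ []) halves-valid zero-or-half
      where
      h : ℕ
      h = suc h′
      h<d : h < d
      h<d = subst (h <_) h+h≡d (m<m+n h (s≤s z≤n))
      half : Fin d
      half = fromℕ< h<d
      zero≢half : ¬ zero ≡ half
      zero≢half eq with trans (cong toℕ eq) (toℕ-fromℕ< h<d)
      ... | ()
      halves-valid : ∀ {c} → c ∈ zero ∷ half ∷ [] → Valid G fE (constant c)
      halves-valid (here refl)        = constant-valid zero ≈-refl
      halves-valid (there (here refl)) = constant-valid half
        (≈-trans (≡⇒≈ (trans (cong (λ m → m + m) (toℕ-fromℕ< h<d)) h+h≡d)) d≈0)
      zero-or-half : ∀ g → Valid G fE g → Σ (Fin d) λ c → c ∈ zero ∷ half ∷ [] × g ≡ constant c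
      zero-or-half g g-valid with classify g g-valid
      ... | c , inj₁ c≡0  , g≡ = c , here (toℕ-injective c≡0) , g≡
      ... | c , inj₂ 2c≡d , g≡ = c , there (here (toℕ-injective
            (trans (double-injective (trans 2c≡d (sym h+h≡d))) (sym (toℕ-fromℕ< h<d))))) , g≡

theorem2 : (d : ℕ) .{{_ : NonZero d}} (n : ℕ) (G : SimpleGraph n) (fE : ELabel n d) →
    Connected G → IsELabeling G fE → Additive G fE →
    (¬ HasOddSimpleCycle G → N G fE ≡ d) ×
    (HasOddSimpleCycle G → (d % 2 ≡ 1 → N G fE ≡ 1) × (d % 2 ≡ 0 → N G fE ≡ 2))
theorem2 (suc k) n G fE (v₀ , path) _ (g₀ , g₀-valid) = count-bipartite v₀ , odd-cycle
  where
  open Count k G fE g₀ g₀-valid path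
  odd-cycle : HasOddSimpleCycle G → (suc k % 2 ≡ 1 → N G fE ≡ 1) × (suc k % 2 ≡ 0 → N G fE ≡ 2)
  odd-cycle has-odd with Walks.cycle⇒odd-closed-walk G has-odd
  ... | b , cw , odd = count-d-odd , count-d-even
    where open OddCycleCase b cw odd
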